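{- Let $\mathbf t=t_0t_1\cdots=01101001\cdots$ be the Thue--Morse word (fixed point of $0\mapsto01$, $1\mapsto10$), and for $i\ge0$ let $A(i,m,n)=(t_{i+k+\ell})_{0\le k<m,0\le\ell<n}$, with $|A(i,m,n)|_1$ its number of $1$ entries. Suppose $m,n\ge3$. Then $\max_{i,j\ge0}\big||A(i,m,n)|_1-|A(j,m,n)|_1\big|=3$ if and only if $m$ and $n$ are both odd. -}

module Defs where

open import Data.Nat using (ℕ; zero; suc; _+_; _∸_)
open import Data.Bool using (Bool; true; false; not)
open import Data.List using (List; []; _∷_; _++_; concatMap; lookup; length)
open import Data.Fin using (Fin)
open import Data.Maybe using (Maybe; just; nothing)

-- Thue–Morse morphism μ : 0 ↦ 01, 1 ↦ 10  (letters: false = 0, true = 1)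
μ : List Bool → List Bool
μ = concatMap (λ b → b ∷ not b ∷ [])

μ^ : ℕ → List Bool
μ^ zero    = false ∷ []
μ^ (suc k) = μ (μ^ k)

_!?_ : List Bool → ℕ → Maybe Bool
[]       !? _     = nothing
(x ∷ xs) !? zero  = just x
(x ∷ xs) !? suc n = xs !? n

-- t_n = n-th letter of the fixed point of μ starting with 0; since
-- |μ^n(0)| = 2^n > n and μ^k(0) is a prefix of μ^(k+1)(0), the letter at
-- position n of μ^(n)(0) is the n-th letter of the fixed point.
-- (The 'nothing' branch never occurs.)
t : ℕ → ℕ
t n with μ^ n !? n
... | just true  = 1
... | just false = 0
... | nothing    = 0

sumTo : ℕ → (ℕ → ℕ) → ℕ
sumTo zero    f = 0
sumTo (suc m) f = sumTo m f + f m

ones : ℕ → ℕ → ℕ → ℕ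
ones i m n = sumTo m (λ k → sumTo n (λ ℓ → t (i + k + ℓ)))

dist : ℕ → ℕ → ℕ
dist a b = (a ∸ b) + (b ∸ a)

MaxDiffIs : ℕ → ℕ → ℕ → Set
MaxDiffIs m n d =
  ((i j : ℕ) → dist (ones i m n) (ones j m n) Data.Nat.≤ d)
  Data.Product.× Data.Product.∃ (λ i → Data.Product.∃ (λ j → dist (ones i m n) (ones j m n) ≡ d))
  where open import Data.Product
        open import Relation.Binary.PropositionalEquality using (_≡_)

-- For odd sides m = 2r + 1 and n = 2p + 1, pairing the rows of A(i,m,n) and using
-- t(2y) = t(y), t(2y + 1) = 1 - t(y) expresses |A(i,m,n)|₁ - ⌊mn/2⌋ through the
-- numbers of ones in two factors of t, of lengths r and r + 1.  A factor of length L
-- contains between ⌈L/2⌉ - 1 and ⌊L/2⌋ + 1 ones, which gives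
-- ⌊mn/2⌋ - 1 ≤ |A(i,m,n)|₁ ≤ ⌊mn/2⌋ + 2.  The upper bound is attained because, for
-- 0 < a < c, t realises every pair of differences t(y) ⊕ t(y + a), t(y) ⊕ t(y + c)
-- except equal letters at y, y + a, y + 2a (an induction halving y, a and c).  As
-- t(x + 2^K) = 1 - t(x) for x < 2^K, some A(j,m,n) has the complementary number
-- mn - |A(i,m,n)|₁ of ones, so the lower bound is attained too.  Conversely, the
-- values being closed under v ↦ mn - v, a maximal difference of 3 between a maximum
-- and a minimum forces mn = 2 min + 3 to be odd.

{-# OPTIONS --safe #-}
module Submission where

open import Data.Bool using (Bool; true; false; not; _xor_)
import Data.Bool.Properties as Bool
open import Data.Bool.Properties
  using (not-distribˡ-xor; not-distribʳ-xor; xor-assoc; xor-same; xor-annihilates-not; ¬-not)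
open import Data.Empty using (⊥-elim)
open import Data.List using ([]; _∷_)
open import Data.Maybe as Maybe using (just; nothing; fromMaybe)
open import Data.Maybe.Properties using (just-injective)
open import Data.Nat
open import Data.Nat.DivMod using (_/_; m%n<n; %-distribˡ-*; m≡m%n+[m/n]*n; [m+kn]%n≡m%n)
open import Data.Nat.Induction using (<-rec)
open import Data.Nat.Properties
open import Algebra.Properties.CommutativeSemigroup +-commutativeSemigroup
  using (interchange; xy∙z≈xz∙y; x∙yz≈y∙xz; x∙yz≈x∙zy)
open import Data.Nat.Tactic.RingSolver using (solve-∀)
open import Data.Product using (_×_; _,_; ∃-syntax; proj₁; proj₂; map₂)
open import Data.Sum as Sum using (_⊎_; inj₁; inj₂; [_,_]′)
open import Defs
open import Function using (_∘_)
open import Function.Bundles using (_⇔_; mk⇔)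
open import Induction.WellFounded using (WfRec)
open import Relation.Binary.Definitions using (tri<; tri≈; tri>)
open import Relation.Binary.PropositionalEquality
open import Relation.Nullary using (¬_; Dec; yes; no)
open import Relation.Nullary.Decidable using (_×-dec_)

toℕ : Bool → ℕ
toℕ false = 0
toℕ true  = 1

infix 6 _+2*_

data Halving : ℕ → Set where
  _+2*_ : ∀ α k → Halving (toℕ α + 2 * k)

halving : ∀ n → Halving n
halving zero = false +2* 0
halving (suc n) with halving n
... | false +2* k = true +2* k
... | true  +2* k = subst Halving (*-suc 2 k) (false +2* suc k)

+2*-suc : ∀ a k → a + 2 * suc k ≡ suc (suc (a + 2 * k))
+2*-suc = solve-∀

halving-< : ∀ α {k n} → k < n → toℕ α + 2 * k < 2 * n
halving-< false     lt = *-monoʳ-< 2 lt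
halving-< true {k} {n} lt = subst (_≤ 2 * n) (*-suc 2 k) (*-monoʳ-≤ 2 lt)

halving-<⁻¹ : ∀ α {k n} → toℕ α + 2 * k < 2 * n → k < n
halving-<⁻¹ α {k} {n} lt = *-cancelˡ-< 2 k n (≤-<-trans (m≤n+m (2 * k) (toℕ α)) lt)

1≤2*n⇒1≤n : ∀ {n} → 1 ≤ 2 * n → 1 ≤ n
1≤2*n⇒1≤n {suc n} _ = s≤s z≤n

n<2*n : ∀ {n} → 1 ≤ n → n < 2 * n
n<2*n {n} 1≤n = m<m+n n (≤-trans 1≤n (m≤m+n n 0))

n<2^n : ∀ n → n < 2 ^ n
n<2^n zero    = s≤s z≤n
n<2^n (suc n) = +-mono-≤ (≤-trans (s≤s z≤n) (n<2^n n)) (≤-trans (n<2^n n) (m≤m+n _ 0))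

μ-!? : ∀ xs α k → μ xs !? (toℕ α + 2 * k) ≡ Maybe.map (α xor_) (xs !? k)
μ-!? []       α     k       = refl
μ-!? (x ∷ xs) false zero    = refl
μ-!? (x ∷ xs) true  zero    = refl
μ-!? (x ∷ xs) α     (suc k) rewrite +2*-suc (toℕ α) k = μ-!? xs α k

μ^-!?-0 : ∀ k → μ^ k !? 0 ≡ just false
μ^-!?-0 zero    = refl
μ^-!?-0 (suc k) = trans (μ-!? (μ^ k) false 0) (cong (Maybe.map (false xor_)) (μ^-!?-0 k))

μ^-!?-agree : ∀ k k' {n} → n < 2 ^ k → n < 2 ^ k' → μ^ k !? n ≡ μ^ k' !? n
μ^-!?-agree zero    k'   (s≤s z≤n) _         = sym (μ^-!?-0 k')
μ^-!?-agree (suc k) zero _         (s≤s z≤n) = μ^-!?-0 (suc k)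
μ^-!?-agree (suc k) (suc k') {n} n<2^k n<2^k' with halving n
... | α +2* m = begin
  μ (μ^ k) !? (toℕ α + 2 * m)      ≡⟨ μ-!? (μ^ k) α m ⟩
  Maybe.map (α xor_) (μ^ k !? m)   ≡⟨ cong (Maybe.map (α xor_)) (μ^-!?-agree k k' m<2^k m<2^k') ⟩
  Maybe.map (α xor_) (μ^ k' !? m)  ≡⟨ μ-!? (μ^ k') α m ⟨
  μ (μ^ k') !? (toℕ α + 2 * m)     ∎
  where
  open ≡-Reasoning
  m<2^k  = halving-<⁻¹ α n<2^k
  m<2^k' = halving-<⁻¹ α n<2^k'

μ^-!?-defined : ∀ k {n} → n < 2 ^ k → ∃[ b ] μ^ k !? n ≡ just b
μ^-!?-defined zero    (s≤s z≤n) = false , refl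
μ^-!?-defined (suc k) {n} n<2^k with halving n
... | α +2* m with μ^-!?-defined k (halving-<⁻¹ α n<2^k)
...   | b , eq = α xor b , trans (μ-!? (μ^ k) α m) (cong (Maybe.map (α xor_)) eq)

tm : ℕ → Bool
tm n = fromMaybe false (μ^ n !? n)

μ^-!? : ∀ k {n} → n < 2 ^ k → μ^ k !? n ≡ just (tm n)
μ^-!? k {n} n<2^k with μ^-!?-defined n (n<2^n n)
... | b , eq = trans (μ^-!?-agree k n n<2^k (n<2^n n)) (trans eq (cong (just ∘ fromMaybe false) (sym eq)))

t≡toℕ∘tm : ∀ n → t n ≡ toℕ (tm n)
t≡toℕ∘tm n with μ^ n !? n
... | just true  = refl
... | just false = refl
... | nothing    = refl

tm-halving : ∀ α n → tm (toℕ α + 2 * n) ≡ α xor tm n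
tm-halving α n = just-injective (begin
  just (tm (toℕ α + 2 * n))       ≡⟨ μ^-!? (suc n) (halving-< α (n<2^n n)) ⟨
  μ (μ^ n) !? (toℕ α + 2 * n)     ≡⟨ μ-!? (μ^ n) α n ⟩
  Maybe.map (α xor_) (μ^ n !? n)  ≡⟨ cong (Maybe.map (α xor_)) (μ^-!? n (n<2^n n)) ⟩
  just (α xor tm n)               ∎)
  where open ≡-Reasoning

tm-+2^ : ∀ K {x} → x < 2 ^ K → tm (x + 2 ^ K) ≡ not (tm x)
tm-+2^ zero    (s≤s z≤n) = refl
tm-+2^ (suc K) {x} x<2^K with halving x
... | α +2* y = begin
  tm (toℕ α + 2 * y + 2 * 2 ^ K)  ≡⟨ cong tm (regroup (toℕ α) y (2 ^ K)) ⟩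
  tm (toℕ α + 2 * (y + 2 ^ K))    ≡⟨ tm-halving α (y + 2 ^ K) ⟩
  α xor tm (y + 2 ^ K)            ≡⟨ cong (α xor_) (tm-+2^ K {y} (halving-<⁻¹ α x<2^K)) ⟩
  α xor not (tm y)                ≡⟨ not-distribʳ-xor α (tm y) ⟨
  not (α xor tm y)                ≡⟨ cong not (tm-halving α y) ⟨
  not (tm (toℕ α + 2 * y))        ∎
  where
  open ≡-Reasoning
  regroup : ∀ a y P → a + 2 * y + 2 * P ≡ a + 2 * (y + P)
  regroup = solve-∀

toℕ-not : ∀ b → toℕ (not b) + toℕ b ≡ 1
toℕ-not false = refl
toℕ-not true  = refl

t-from-tm : ∀ {y u} → tm y ≡ u → t y ≡ toℕ u
t-from-tm {y} tm-y≡u = trans (t≡toℕ∘tm y) (cong toℕ tm-y≡u)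

t-double : ∀ n → t (2 * n) ≡ t n
t-double n = trans (t-from-tm {2 * n} (tm-halving false n)) (sym (t≡toℕ∘tm n))

t-double+1 : ∀ n → t (suc (2 * n)) + t n ≡ 1
t-double+1 n = begin
  t (suc (2 * n)) + t n          ≡⟨ cong₂ _+_ (t-from-tm {suc (2 * n)} (tm-halving true n)) (t≡toℕ∘tm n) ⟩
  toℕ (not (tm n)) + toℕ (tm n)  ≡⟨ toℕ-not (tm n) ⟩
  1                              ∎
  where open ≡-Reasoning

t-pair : ∀ n → t (2 * n) + t (suc (2 * n)) ≡ 1
t-pair n = trans (cong (_+ t (suc (2 * n))) (t-double n)) (trans (+-comm (t n) _) (t-double+1 n))

t-+2^ : ∀ K {x} → x < 2 ^ K → t (x + 2 ^ K) + t x ≡ 1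
t-+2^ K {x} x<2^K = begin
  t (x + 2 ^ K) + t x            ≡⟨ cong₂ _+_ (t-from-tm {x + 2 ^ K} (tm-+2^ K x<2^K)) (t≡toℕ∘tm x) ⟩
  toℕ (not (tm x)) + toℕ (tm x)  ≡⟨ toℕ-not (tm x) ⟩
  1                              ∎
  where open ≡-Reasoning

t≤1 : ∀ n → t n ≤ 1
t≤1 n with tm n | t≡toℕ∘tm n
... | false | t≡0 = ≤-trans (≤-reflexive t≡0) z≤n
... | true  | t≡1 = ≤-reflexive t≡1

-- Patterns of differences

Δ : ℕ → ℕ → Bool
Δ y d = tm y xor tm (y + d)

xor-cancel : ∀ α δ → α xor (α xor δ) ≡ δ
xor-cancel α δ = trans (sym (xor-assoc α α δ)) (cong (_xor δ) (xor-same α))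

xor-inner : ∀ α x y → x xor (α xor y) ≡ α xor (x xor y)
xor-inner false x y = refl
xor-inner true  x y = sym (not-distribʳ-xor x y)

Δ-double : ∀ z α d → Δ (2 * z) (toℕ α + 2 * d) ≡ α xor Δ z d
Δ-double z α d = begin
  tm (2 * z) xor tm (2 * z + (toℕ α + 2 * d))
    ≡⟨ cong₂ _xor_ (tm-halving false z)
                   (trans (cong tm (regroup (toℕ α) z d)) (tm-halving α (z + d))) ⟩
  tm z xor (α xor tm (z + d))  ≡⟨ xor-inner α (tm z) (tm (z + d)) ⟩
  α xor Δ z d                  ∎
  where
  open ≡-Reasoning
  regroup : ∀ a z d → 2 * z + (a + 2 * d) ≡ a + 2 * (z + d)
  regroup = solve-∀

Δ-double+1 : ∀ z α d → Δ (suc (2 * z)) (toℕ α + 2 * d) ≡ α xor Δ z (toℕ α + d)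
Δ-double+1 z false d = begin
  tm (suc (2 * z)) xor tm (suc (2 * z + 2 * d))
    ≡⟨ cong₂ _xor_ (tm-halving true z)
                   (trans (cong (tm ∘ suc) (sym (*-distribˡ-+ 2 z d))) (tm-halving true (z + d))) ⟩
  not (tm z) xor not (tm (z + d))  ≡⟨ xor-annihilates-not (tm z) (tm (z + d)) ⟩
  Δ z d                            ∎
  where open ≡-Reasoning
Δ-double+1 z true d = begin
  tm (suc (2 * z)) xor tm (suc (2 * z) + suc (2 * d))
    ≡⟨ cong₂ _xor_ (tm-halving true z)
                   (trans (cong tm (regroup z d)) (tm-halving false (z + suc d))) ⟩
  not (tm z) xor tm (z + suc d)  ≡⟨ not-distribˡ-xor (tm z) (tm (z + suc d)) ⟨
  not (Δ z (suc d))              ∎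
  where
  open ≡-Reasoning
  regroup : ∀ z d → suc (2 * z) + suc (2 * d) ≡ 2 * (z + suc d)
  regroup = solve-∀

Δ-+2^ : ∀ K {y d} → y + d < 2 ^ K → Δ (y + 2 ^ K) d ≡ Δ y d
Δ-+2^ K {y} {d} y+d<2^K = begin
  tm (y + 2 ^ K) xor tm (y + 2 ^ K + d)
    ≡⟨ cong₂ _xor_ (tm-+2^ K (≤-<-trans (m≤m+n y d) y+d<2^K))
                   (trans (cong tm (xy∙z≈xz∙y y (2 ^ K) d)) (tm-+2^ K y+d<2^K)) ⟩
  not (tm y) xor not (tm (y + d))  ≡⟨ xor-annihilates-not (tm y) (tm (y + d)) ⟩
  Δ y d                            ∎
  where open ≡-Reasoning

Occurs : ℕ → ℕ → Bool → Bool → Set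
Occurs a c δ ε = ∃[ y ] Δ y a ≡ δ × Δ y c ≡ ε

occurs-double : ∀ α γ {a c δ ε} → Occurs a c (α xor δ) (γ xor ε) →
                Occurs (toℕ α + 2 * a) (toℕ γ + 2 * c) δ ε
occurs-double α γ (z , Δa , Δc) = 2 * z , lift α Δa , lift γ Δc
  where
  lift : ∀ α {d δ} → Δ z d ≡ α xor δ → Δ (2 * z) (toℕ α + 2 * d) ≡ δ
  lift α {d} {δ} eq = trans (Δ-double z α d) (trans (cong (α xor_) eq) (xor-cancel α δ))

occurs-double+1 : ∀ α γ {a c δ ε} → Occurs (toℕ α + a) (toℕ γ + c) (α xor δ) (γ xor ε) →
                  Occurs (toℕ α + 2 * a) (toℕ γ + 2 * c) δ ε
occurs-double+1 α γ (z , Δa , Δc) = suc (2 * z) , lift α Δa , lift γ Δc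
  where
  lift : ∀ α {d δ} → Δ z (toℕ α + d) ≡ α xor δ → Δ (suc (2 * z)) (toℕ α + 2 * d) ≡ δ
  lift α {d} {δ} eq = trans (Δ-double+1 z α d) (trans (cong (α xor_) eq) (xor-cancel α δ))

occurs-swap : ∀ {a c δ ε} → Occurs a c δ ε → Occurs c a ε δ
occurs-swap (y , Δa , Δc) = y , Δc , Δa

occurs-zero : ∀ {c ε} → Occurs c c ε ε → Occurs 0 c false ε
occurs-zero (y , _ , Δc) = y , trans (cong (λ z → tm y xor tm z) (+-identityʳ y)) (xor-same (tm y)) , Δc

occurs-diagonal : ∀ d → 1 ≤ d → ∀ δ → Occurs d d δ δ
occurs-diagonal = <-rec (λ d → 1 ≤ d → ∀ δ → Occurs d d δ δ) step
  where
  step : ∀ d → WfRec _<_ (λ d → 1 ≤ d → ∀ δ → Occurs d d δ δ) d → 1 ≤ d → ∀ δ → Occurs d d δ δ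
  step d rec 1≤d δ with halving d
  ... | false +2* d' = occurs-double false false (rec {d'} (n<2*n 1≤d') 1≤d' δ)
    where 1≤d' = 1≤2*n⇒1≤n {d'} 1≤d
  ... | true +2* zero with δ
  ...   | false = 1 , refl , refl
  ...   | true  = 0 , refl , refl
  step d rec 1≤d δ | true +2* suc d' =
    occurs-double true true (rec {suc d'} (s≤s (<⇒≤ (n<2*n (s≤s z≤n)))) (s≤s z≤n) (not δ))

-- Equal letters at y, y + a and y + 2a: for a = 1 this would be a cube, and t has none.
Exceptional : ℕ → ℕ → Bool → Bool → Set
Exceptional a c δ ε = δ ≡ false × ε ≡ false × c ≡ 2 * a

exceptional? : ∀ a c δ ε → Dec (Exceptional a c δ ε)
exceptional? a c δ ε = δ Bool.≟ false ×-dec ε Bool.≟ false ×-dec c ≟ 2 * a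

¬Exceptional-true : ∀ {a c ε} → ¬ Exceptional a c true ε
¬Exceptional-true (() , _)

AllOccurAt : ℕ → Set
AllOccurAt c = ∀ {a} → 1 ≤ a → a < c → ∀ δ ε → ¬ Exceptional a c δ ε → Occurs a c δ ε

-- In each parity case the pattern is pulled back along y = 2z or y = 2z + 1, whichever
-- halves it to a pattern that is not exceptional (or degenerate: a = 0 or a = c).
occurs-even-odd : ∀ {a c} → WfRec _<_ AllOccurAt (suc (2 * c)) → 1 ≤ a → a ≤ c → ∀ δ ε →
                  Occurs (2 * a) (suc (2 * c)) δ ε
occurs-even-odd {a} {c} rec 1≤a a≤c δ ε with exceptional? a (suc c) δ (not ε)
... | no ¬exc =
  occurs-double+1 false true {a} {c} (rec (s≤s (n<2*n (≤-trans 1≤a a≤c))) 1≤a (s≤s a≤c) δ (not ε) ¬exc)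
... | yes (refl , not-ε≡false , 1+c≡2a) =
  occurs-double false true {a} {c} (subst (Occurs a c false) (sym not-ε≡false) fallback)
  where
  fallback : Occurs a c false false
  fallback with a ≟ c
  ... | yes refl = occurs-diagonal a 1≤a false
  ... | no  a≢c  = rec (s≤s (m≤m+n c _)) 1≤a (≤∧≢⇒< a≤c a≢c) false false
                       (λ (_ , _ , c≡2a) → 1+n≢n (trans 1+c≡2a (sym c≡2a)))

occurs-odd-even : ∀ {a c} → WfRec _<_ AllOccurAt (2 * c) → a < c → ∀ δ ε →
                  ¬ Exceptional (suc (2 * a)) (2 * c) δ ε → Occurs (suc (2 * a)) (2 * c) δ ε
occurs-odd-even {zero} {suc zero} rec _ false true _ =
  occurs-double+1 true false {0} {1} (occurs-diagonal 1 (s≤s z≤n) true)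
occurs-odd-even {zero} {suc zero} rec _ false false ¬exc = ⊥-elim (¬exc (refl , refl , refl))
occurs-odd-even {zero} {suc (suc c)} rec _ false ε _ =
  occurs-double+1 true false {0} {suc (suc c)}
    (rec (n<2*n (s≤s z≤n)) (s≤s z≤n) (s≤s (s≤s z≤n)) true ε (¬Exceptional-true {1}))
occurs-odd-even {zero} {c} rec 0<c true ε _ =
  occurs-double true false {0} {c} (occurs-zero (occurs-diagonal c 0<c ε))
occurs-odd-even {suc a} {c} rec a<c false ε _ =
  occurs-double true false {suc a} {c}
    (rec (n<2*n (≤-trans (s≤s z≤n) a<c)) (s≤s z≤n) a<c true ε (¬Exceptional-true {suc a}))
occurs-odd-even {suc a} {c} rec a<c true ε _ with exceptional? (suc a) c false ε
... | no ¬exc =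
  occurs-double true false {suc a} {c} (rec (n<2*n (≤-trans (s≤s z≤n) a<c)) (s≤s z≤n) a<c false ε ¬exc)
... | yes (_ , refl , c≡2a) = occurs-double+1 true false {suc a} {c} fallback
  where
  fallback : Occurs (suc (suc a)) c false false
  fallback with suc (suc a) ≟ c
  ... | yes refl = occurs-diagonal (suc (suc a)) (s≤s z≤n) false
  ... | no  2+a≢c = rec (n<2*n (≤-trans (s≤s z≤n) a<c)) (s≤s z≤n) (≤∧≢⇒< a<c 2+a≢c) false false
    (λ (_ , _ , c≡4+2a) → 1+n≢n (sym (*-cancelˡ-≡ (suc a) (suc (suc a)) 2 (trans (sym c≡2a) c≡4+2a))))

occurs-odd-odd : ∀ {a c} → WfRec _<_ AllOccurAt (suc (2 * c)) → a < c → ∀ δ ε →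
                 Occurs (suc (2 * a)) (suc (2 * c)) δ ε
occurs-odd-odd {a} {c} rec a<c δ ε with exceptional? (suc a) (suc c) (not δ) (not ε)
... | no ¬exc =
  occurs-double+1 true true {a} {c} (rec (s≤s (n<2*n 1≤c)) (s≤s z≤n) (s≤s a<c) (not δ) (not ε) ¬exc)
  where 1≤c = ≤-trans (s≤s z≤n) a<c
... | yes (not-δ≡false , not-ε≡false , 1+c≡2+2a) =
  occurs-double true true {a} {c}
    (subst₂ (Occurs a c) (sym not-δ≡false) (sym not-ε≡false) (fallback a<c 1+c≡2+2a))
  where
  fallback : ∀ {a} → a < c → suc c ≡ 2 * suc a → Occurs a c false false
  fallback {zero}  a<c _        = occurs-zero (occurs-diagonal c a<c false)
  fallback {suc a} a<c 1+c≡2+2a = rec (s≤s (m≤m+n c _)) (s≤s z≤n) a<c false false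
    (λ (_ , _ , c≡2a) → 1+n≢n (trans (sym (suc-injective (trans 1+c≡2+2a (*-suc 2 (suc a))))) c≡2a))

occurs : ∀ c → AllOccurAt c
occurs = <-rec AllOccurAt step
  where
  step : ∀ c → WfRec _<_ AllOccurAt c → AllOccurAt c
  step c rec {a} 1≤a a<c δ ε ¬exc with halving a | halving c
  ... | false +2* a' | false +2* c' =
    occurs-double false false {a'} {c'} (rec (n<2*n (≤-trans 1≤a' (<⇒≤ a'<c'))) 1≤a' a'<c' δ ε
      (λ (δ≡false , ε≡false , c'≡2a') → ¬exc (δ≡false , ε≡false , cong (2 *_) c'≡2a')))
    where
    1≤a'  = 1≤2*n⇒1≤n {a'} 1≤a
    a'<c' = halving-<⁻¹ false a<c
  ... | false +2* a' | true  +2* c' =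
    occurs-even-odd {a'} {c'} rec (1≤2*n⇒1≤n {a'} 1≤a) (*-cancelˡ-≤ 2 (≤-pred a<c)) δ ε
  ... | true  +2* a' | false +2* c' = occurs-odd-even {a'} {c'} rec (halving-<⁻¹ true a<c) δ ε ¬exc
  ... | true  +2* a' | true  +2* c' = occurs-odd-odd {a'} {c'} rec (halving-<⁻¹ false (≤-pred a<c)) δ ε

tm-from-Δ : ∀ {y d u v} → tm y ≡ u → Δ y d ≡ u xor v → tm (y + d) ≡ v
tm-from-Δ {y} {d} {u} {v} tm-y≡u Δ≡ = begin
  tm (y + d)       ≡⟨ xor-cancel (tm y) (tm (y + d)) ⟨
  tm y xor Δ y d   ≡⟨ cong₂ _xor_ tm-y≡u Δ≡ ⟩
  u xor (u xor v)  ≡⟨ xor-cancel u v ⟩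
  v                ∎
  where open ≡-Reasoning

occurs-letters : ∀ {a c u v w} → Occurs a c (u xor v) (u xor w) →
                 ∃[ y ] tm y ≡ u × tm (y + a) ≡ v × tm (y + c) ≡ w
occurs-letters {a} {c} {u} (y , Δa , Δc) with tm y Bool.≟ u
... | yes tm-y≡u = y , tm-y≡u , tm-from-Δ {y} {a} tm-y≡u Δa , tm-from-Δ {y} {c} tm-y≡u Δc
... | no  tm-y≢u = y + 2 ^ K , tm≡u ,
                   tm-from-Δ {y + 2 ^ K} {a} tm≡u (trans (Δ-+2^ K {y} {a} y+a<2^K) Δa) ,
                   tm-from-Δ {y + 2 ^ K} {c} tm≡u (trans (Δ-+2^ K {y} {c} y+c<2^K) Δc)
  where
  K = y + (a + c)
  y+a<2^K = ≤-<-trans (+-monoʳ-≤ y (m≤m+n a c)) (n<2^n K)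
  y+c<2^K = ≤-<-trans (+-monoʳ-≤ y (m≤n+m c a)) (n<2^n K)
  tm≡u : tm (y + 2 ^ K) ≡ u
  tm≡u = trans (tm-+2^ K {y} (≤-<-trans (m≤m+n y a) y+a<2^K)) (sym (¬-not (tm-y≢u ∘ sym)))

occurs-true-true : ∀ {a c} → 1 ≤ a → 1 ≤ c → Occurs a c true true
occurs-true-true {a} {c} 1≤a 1≤c with <-cmp a c
... | tri< a<c _ _  = occurs c 1≤a a<c true true (¬Exceptional-true {a})
... | tri≈ _ refl _ = occurs-diagonal a 1≤a true
... | tri> _ _ c<a  = occurs-swap (occurs a 1≤c c<a true true (¬Exceptional-true {c}))

pattern-100 : ∀ {a c} → 1 ≤ a → 1 ≤ c → ∃[ y ] t y ≡ 1 × t (y + a) ≡ 0 × t (y + c) ≡ 0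
pattern-100 {a} {c} 1≤a 1≤c with occurs-letters {u = true} {false} {false} (occurs-true-true 1≤a 1≤c)
... | y , p , q , r = y , t-from-tm {y} p , t-from-tm {y + a} q , t-from-tm {y + c} r

pattern-101 : ∀ {a c} → 1 ≤ a → a < c → ∃[ y ] t y ≡ 1 × t (y + a) ≡ 0 × t (y + c) ≡ 1
pattern-101 {a} {c} 1≤a a<c
  with occurs-letters {u = true} {false} {true} (occurs c 1≤a a<c true false (¬Exceptional-true {a}))
... | y , p , q , r = y , t-from-tm {y} p , t-from-tm {y + a} q , t-from-tm {y + c} r

-- Weights of factors

sumTo-cong : ∀ m {f g} → (∀ k → k < m → f k ≡ g k) → sumTo m f ≡ sumTo m g
sumTo-cong zero    f≗g = refl
sumTo-cong (suc m) f≗g = cong₂ _+_ (sumTo-cong m (λ k k<m → f≗g k (m<n⇒m<1+n k<m))) (f≗g m (n<1+n m))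

sumTo-+ : ∀ m f g → sumTo m (λ k → f k + g k) ≡ sumTo m f + sumTo m g
sumTo-+ zero    f g = refl
sumTo-+ (suc m) f g =
  trans (cong (_+ (f m + g m)) (sumTo-+ m f g)) (interchange (sumTo m f) (sumTo m g) (f m) (g m))

sumTo-const : ∀ m c → sumTo m (λ _ → c) ≡ m * c
sumTo-const zero    c = refl
sumTo-const (suc m) c = trans (cong (_+ c) (sumTo-const m c)) (+-comm (m * c) c)

sumTo-pointwise : ∀ r {f g h c} → (∀ a → f a + g a ≡ c + h a) →
                  sumTo r f + sumTo r g ≡ r * c + sumTo r h
sumTo-pointwise r {f} {g} {h} {c} eq = begin
  sumTo r f + sumTo r g          ≡⟨ sumTo-+ r f g ⟨
  sumTo r (λ a → f a + g a)      ≡⟨ sumTo-cong r (λ a _ → eq a) ⟩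
  sumTo r (λ a → c + h a)        ≡⟨ sumTo-+ r (λ _ → c) h ⟩
  sumTo r (λ _ → c) + sumTo r h  ≡⟨ cong (_+ sumTo r h) (sumTo-const r c) ⟩
  r * c + sumTo r h              ∎
  where open ≡-Reasoning

sumTo-suc : ∀ m f → sumTo (suc m) f ≡ f 0 + sumTo m (f ∘ suc)
sumTo-suc zero    f = +-comm 0 (f 0)
sumTo-suc (suc m) f = trans (cong (_+ f (suc m)) (sumTo-suc m f)) (+-assoc (f 0) _ _)

sumTo-1+2* : ∀ r g → sumTo (suc (2 * r)) g ≡ sumTo r (λ a → g (2 * a) + g (suc (2 * a))) + g (2 * r)
sumTo-1+2* r g = cong (_+ g (2 * r)) (sumTo-2* r)
  where
  sumTo-2* : ∀ r → sumTo (2 * r) g ≡ sumTo r (λ a → g (2 * a) + g (suc (2 * a)))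
  sumTo-2* zero    = refl
  sumTo-2* (suc r) = begin
    sumTo (2 * suc r) g                                ≡⟨ cong (λ k → sumTo k g) (*-suc 2 r) ⟩
    sumTo (2 * r) g + g (2 * r) + g (suc (2 * r))      ≡⟨ +-assoc (sumTo (2 * r) g) _ _ ⟩
    sumTo (2 * r) g + (g (2 * r) + g (suc (2 * r)))    ≡⟨ cong (_+ (g (2 * r) + g (suc (2 * r)))) (sumTo-2* r) ⟩
    sumTo (suc r) (λ a → g (2 * a) + g (suc (2 * a)))  ∎
    where open ≡-Reasoning

weight : ℕ → ℕ → ℕ
weight x L = sumTo L (λ j → t (x + j))

weight-suc : ∀ x L → weight x (suc L) ≡ t x + weight (suc x) L
weight-suc x L = trans (sumTo-suc L (λ j → t (x + j)))
  (cong₂ _+_ (cong t (+-identityʳ x)) (sumTo-cong L (λ j _ → cong t (+-suc x j))))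

weight-+2^ : ∀ K {x} L → x + L ≤ 2 ^ K → weight (x + 2 ^ K) L + weight x L ≡ L
weight-+2^ K {x} L x+L≤2^K = begin
  weight (x + 2 ^ K) L + weight x L              ≡⟨ sumTo-+ L _ _ ⟨
  sumTo L (λ j → t (x + 2 ^ K + j) + t (x + j))  ≡⟨ sumTo-cong L letters ⟩
  sumTo L (λ _ → 1)                              ≡⟨ sumTo-const L 1 ⟩
  L * 1                                          ≡⟨ *-identityʳ L ⟩
  L                                              ∎
  where
  open ≡-Reasoning
  letters : ∀ j → j < L → t (x + 2 ^ K + j) + t (x + j) ≡ 1
  letters j j<L = trans (cong (λ k → t k + t (x + j)) (xy∙z≈xz∙y x (2 ^ K) j))
                        (t-+2^ K (<-≤-trans (+-monoʳ-< x j<L) x+L≤2^K))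

2*-+1+2* : ∀ y q → 2 * y + suc (2 * q) ≡ suc (2 * (y + q))
2*-+1+2* = solve-∀

1+2*-+1+2* : ∀ y q → suc (2 * y) + suc (2 * q) ≡ 2 * suc (y + q)
1+2*-+1+2* = solve-∀

weight-even-even : ∀ y q → weight (2 * y) (2 * q) ≡ q
weight-even-even y zero    = refl
weight-even-even y (suc q) = begin
  weight (2 * y) (2 * suc q)
    ≡⟨ cong (weight (2 * y)) (*-suc 2 q) ⟩
  weight (2 * y) (2 * q) + t (2 * y + 2 * q) + t (2 * y + suc (2 * q))
    ≡⟨ +-assoc (weight (2 * y) (2 * q)) _ _ ⟩
  weight (2 * y) (2 * q) + (t (2 * y + 2 * q) + t (2 * y + suc (2 * q)))
    ≡⟨ cong₂ _+_ (weight-even-even y q)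
                 (cong₂ _+_ (cong t (sym (*-distribˡ-+ 2 y q))) (cong t (2*-+1+2* y q))) ⟩
  q + (t (2 * (y + q)) + t (suc (2 * (y + q))))
    ≡⟨ cong (q +_) (t-pair (y + q)) ⟩
  q + 1
    ≡⟨ +-comm q 1 ⟩
  suc q ∎
  where open ≡-Reasoning

weight-even-odd : ∀ y q → weight (2 * y) (suc (2 * q)) ≡ q + t (y + q)
weight-even-odd y q =
  cong₂ _+_ (weight-even-even y q) (trans (cong t (sym (*-distribˡ-+ 2 y q))) (t-double (y + q)))

weight-odd-even : ∀ y q → weight (suc (2 * y)) (2 * q) + t y ≡ q + t (y + q)
weight-odd-even y q = begin
  weight (suc (2 * y)) (2 * q) + t y        ≡⟨ +-comm _ (t y) ⟩
  t y + weight (suc (2 * y)) (2 * q)        ≡⟨ cong (_+ weight (suc (2 * y)) (2 * q)) (t-double y) ⟨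
  t (2 * y) + weight (suc (2 * y)) (2 * q)  ≡⟨ weight-suc (2 * y) (2 * q) ⟨
  weight (2 * y) (suc (2 * q))              ≡⟨ weight-even-odd y q ⟩
  q + t (y + q)                             ∎
  where open ≡-Reasoning

weight-odd-odd : ∀ y q → weight (suc (2 * y)) (suc (2 * q)) + t y ≡ suc q
weight-odd-odd y q = begin
  weight (suc (2 * y)) (suc (2 * q)) + t y        ≡⟨ +-comm _ (t y) ⟩
  t y + weight (suc (2 * y)) (suc (2 * q))        ≡⟨ cong (_+ weight (suc (2 * y)) (suc (2 * q))) (t-double y) ⟨
  t (2 * y) + weight (suc (2 * y)) (suc (2 * q))  ≡⟨ weight-suc (2 * y) (suc (2 * q)) ⟨
  weight (2 * y) (suc (suc (2 * q)))              ≡⟨ cong (weight (2 * y)) (*-suc 2 q) ⟨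
  weight (2 * y) (2 * suc q)                      ≡⟨ weight-even-even y (suc q) ⟩
  suc q                                           ∎
  where open ≡-Reasoning

⌊α+2*k/2⌋≡k : ∀ α k → ⌊ toℕ α + 2 * k /2⌋ ≡ k
⌊α+2*k/2⌋≡k false zero    = refl
⌊α+2*k/2⌋≡k true  zero    = refl
⌊α+2*k/2⌋≡k α     (suc k) = trans (cong ⌊_/2⌋ (+2*-suc (toℕ α) k)) (cong suc (⌊α+2*k/2⌋≡k α k))

⌈α+2*k/2⌉≡α+k : ∀ α k → ⌈ toℕ α + 2 * k /2⌉ ≡ toℕ α + k
⌈α+2*k/2⌉≡α+k false k = ⌊α+2*k/2⌋≡k true k
⌈α+2*k/2⌉≡α+k true  k = cong suc (⌊α+2*k/2⌋≡k false k)

near : ∀ {w e q f} → w + e ≡ q + f → e ≤ 1 → f ≤ 1 → w ≤ suc q × q ≤ suc w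
near {w} {e} {q} {f} eq e≤1 f≤1 =
  (begin
    w      ≤⟨ m≤m+n w e ⟩
    w + e  ≡⟨ eq ⟩
    q + f  ≤⟨ +-monoʳ-≤ q f≤1 ⟩
    q + 1  ≡⟨ +-comm q 1 ⟩
    suc q  ∎) ,
  (begin
    q      ≤⟨ m≤m+n q f ⟩
    q + f  ≡⟨ eq ⟨
    w + e  ≤⟨ +-monoʳ-≤ w e≤1 ⟩
    w + 1  ≡⟨ +-comm w 1 ⟩
    suc w  ∎)
  where open ≤-Reasoning

near-above : ∀ {w e q f} → w + e ≡ q + f → e ≤ f → f ≤ 1 → w ≤ suc q × suc q ≤ suc w
near-above {w} {e} {q} {f} eq e≤f f≤1 =
  proj₁ (near eq (≤-trans e≤f f≤1) f≤1) ,
  s≤s (+-cancelʳ-≤ f q w (≤-trans (≤-reflexive (sym eq)) (+-monoʳ-≤ w e≤f)))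

weight-bounds : ∀ x L → weight x L ≤ suc ⌊ L /2⌋ × ⌈ L /2⌉ ≤ suc (weight x L)
weight-bounds x L with halving L
... | β +2* q = subst₂ (λ k k' → weight x L' ≤ suc k × k' ≤ suc (weight x L'))
                       (sym (⌊α+2*k/2⌋≡k β q)) (sym (⌈α+2*k/2⌉≡α+k β q)) (bounds β (halving x))
  where
  L' = toℕ β + 2 * q
  bounds : ∀ β {x} → Halving x → weight x (toℕ β + 2 * q) ≤ suc q × toℕ β + q ≤ suc (weight x (toℕ β + 2 * q))
  bounds false (false +2* y) =
    near (trans (+-identityʳ _) (trans (weight-even-even y q) (sym (+-identityʳ q)))) z≤n z≤n
  bounds false (true  +2* y) = near (weight-odd-even y q) (t≤1 y) (t≤1 (y + q))
  bounds true  (false +2* y) = near-above (trans (+-identityʳ _) (weight-even-odd y q)) z≤n (t≤1 (y + q))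
  bounds true  (true  +2* y) = near-above (trans (weight-odd-odd y q) (+-comm 1 q)) (t≤1 y) ≤-refl

weight-compare : ∀ x x' r → weight x (suc r) ≤ 2 + weight x' r × weight x' r ≤ 1 + weight x (suc r)
weight-compare x x' r =
  ≤-trans (proj₁ (weight-bounds x (suc r))) (s≤s (proj₂ (weight-bounds x' r))) ,
  ≤-trans (proj₁ (weight-bounds x' r)) (proj₂ (weight-bounds x (suc r)))

weight-odd-even-min : ∀ y q → t y ≡ 1 → t (y + q) ≡ 0 → suc (weight (suc (2 * y)) (2 * q)) ≡ q
weight-odd-even-min y q ty≡1 tyq≡0 = begin
  suc (weight (suc (2 * y)) (2 * q))  ≡⟨ +-comm 1 _ ⟩
  weight (suc (2 * y)) (2 * q) + 1    ≡⟨ cong (weight (suc (2 * y)) (2 * q) +_) ty≡1 ⟨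
  weight (suc (2 * y)) (2 * q) + t y  ≡⟨ weight-odd-even y q ⟩
  q + t (y + q)                       ≡⟨ cong (q +_) tyq≡0 ⟩
  q + 0                               ≡⟨ +-identityʳ q ⟩
  q                                   ∎
  where open ≡-Reasoning

weight-odd-even-max : ∀ y q → t y ≡ 0 → t (y + q) ≡ 1 → weight (suc (2 * y)) (2 * q) ≡ suc q
weight-odd-even-max y q ty≡0 tyq≡1 = begin
  weight (suc (2 * y)) (2 * q)        ≡⟨ +-identityʳ _ ⟨
  weight (suc (2 * y)) (2 * q) + 0    ≡⟨ cong (weight (suc (2 * y)) (2 * q) +_) ty≡0 ⟨
  weight (suc (2 * y)) (2 * q) + t y  ≡⟨ weight-odd-even y q ⟩
  q + t (y + q)                       ≡⟨ cong (q +_) tyq≡1 ⟩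
  q + 1                               ≡⟨ +-comm q 1 ⟩
  suc q                               ∎
  where open ≡-Reasoning

weight-odd-odd-min : ∀ y q → t y ≡ 1 → weight (suc (2 * y)) (suc (2 * q)) ≡ q
weight-odd-odd-min y q ty≡1 = suc-injective (begin
  suc (weight (suc (2 * y)) (suc (2 * q)))  ≡⟨ +-comm 1 _ ⟩
  weight (suc (2 * y)) (suc (2 * q)) + 1    ≡⟨ cong (weight (suc (2 * y)) (suc (2 * q)) +_) ty≡1 ⟨
  weight (suc (2 * y)) (suc (2 * q)) + t y  ≡⟨ weight-odd-odd y q ⟩
  suc q                                     ∎)
  where open ≡-Reasoning

weight-odd-odd-max : ∀ y q → t y ≡ 0 → weight (suc (2 * y)) (suc (2 * q)) ≡ suc q
weight-odd-odd-max y q ty≡0 = begin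
  weight (suc (2 * y)) (suc (2 * q))        ≡⟨ +-identityʳ _ ⟨
  weight (suc (2 * y)) (suc (2 * q)) + 0    ≡⟨ cong (weight (suc (2 * y)) (suc (2 * q)) +_) ty≡0 ⟨
  weight (suc (2 * y)) (suc (2 * q)) + t y  ≡⟨ weight-odd-odd y q ⟩
  suc q                                     ∎
  where open ≡-Reasoning

weight-even-odd-max : ∀ y q → t (y + q) ≡ 1 → weight (2 * y) (suc (2 * q)) ≡ suc q
weight-even-odd-max y q tyq≡1 = trans (weight-even-odd y q) (trans (cong (q +_) tyq≡1) (+-comm q 1))

-- Ones in the arrays A(i, 2r + 1, 2p + 1)

-- ⌊mn/2⌋ for m = 2r + 1 and n = 2p + 1.
mid : ℕ → ℕ → ℕ
mid r p = r * suc (2 * p) + p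

ones-even : ∀ b r p → ones (2 * b) (suc (2 * r)) (suc (2 * p)) + weight b r ≡
                      mid r p + weight (b + p) (suc r)
ones-even b r p = begin
  ones (2 * b) (suc (2 * r)) n + weight b r       ≡⟨ cong (_+ weight b r) (sumTo-1+2* r row) ⟩
  sumTo r pair + row (2 * r) + weight b r         ≡⟨ xy∙z≈xz∙y (sumTo r pair) (row (2 * r)) (weight b r) ⟩
  sumTo r pair + weight b r + row (2 * r)         ≡⟨ cong₂ _+_ (sumTo-pointwise r pair+letter) (even-row r) ⟩
  r * n + weight (b + p) r + (p + t (b + r + p))  ≡⟨ cong (λ k → r * n + weight (b + p) r + (p + t k))
                                                           (xy∙z≈xz∙y b r p) ⟩
  r * n + weight (b + p) r + (p + t (b + p + r))  ≡⟨ interchange (r * n) (weight (b + p) r) p (t (b + p + r)) ⟩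
  mid r p + weight (b + p) (suc r)                ∎
  where
  open ≡-Reasoning
  n = suc (2 * p)
  row : ℕ → ℕ
  row k = weight (2 * b + k) n
  pair : ℕ → ℕ
  pair a = row (2 * a) + row (suc (2 * a))
  even-row : ∀ a → row (2 * a) ≡ p + t (b + a + p)
  even-row a = trans (cong (λ x → weight x n) (sym (*-distribˡ-+ 2 b a))) (weight-even-odd (b + a) p)
  odd-row : ∀ a → row (suc (2 * a)) + t (b + a) ≡ suc p
  odd-row a = trans (cong (λ x → weight x n + t (b + a)) (2*-+1+2* b a)) (weight-odd-odd (b + a) p)
  pair+letter : ∀ a → pair a + t (b + a) ≡ n + t (b + p + a)
  pair+letter a = begin
    row (2 * a) + row (suc (2 * a)) + t (b + a)    ≡⟨ +-assoc (row (2 * a)) _ _ ⟩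
    row (2 * a) + (row (suc (2 * a)) + t (b + a))  ≡⟨ cong₂ _+_ (even-row a) (odd-row a) ⟩
    p + t (b + a + p) + suc p                      ≡⟨ regroup p (t (b + a + p)) ⟩
    n + t (b + a + p)                              ≡⟨ cong (λ k → n + t k) (xy∙z≈xz∙y b a p) ⟩
    n + t (b + p + a)                              ∎
    where
    regroup : ∀ p u → p + u + suc p ≡ suc (2 * p) + u
    regroup = solve-∀

ones-odd : ∀ b r p → ones (suc (2 * b)) (suc (2 * r)) (suc (2 * p)) + weight b (suc r) ≡
                     suc (mid r p) + weight (suc (b + p)) r
ones-odd b r p = begin
  ones (suc (2 * b)) (suc (2 * r)) n + weight b (suc r)  ≡⟨ cong (_+ weight b (suc r)) (sumTo-1+2* r row) ⟩
  sumTo r pair + row (2 * r) + (weight b r + t (b + r))  ≡⟨ interchange (sumTo r pair) (row (2 * r)) _ _ ⟩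
  sumTo r pair + weight b r + (row (2 * r) + t (b + r))  ≡⟨ cong₂ _+_ (sumTo-pointwise r pair+letter) (even-row r) ⟩
  r * n + weight (suc (b + p)) r + suc p                 ≡⟨ regroup (r * n) (weight (suc (b + p)) r) p ⟩
  suc (mid r p) + weight (suc (b + p)) r                 ∎
  where
  open ≡-Reasoning
  n = suc (2 * p)
  row : ℕ → ℕ
  row k = weight (suc (2 * b) + k) n
  pair : ℕ → ℕ
  pair a = row (2 * a) + row (suc (2 * a))
  even-row : ∀ a → row (2 * a) + t (b + a) ≡ suc p
  even-row a = trans (cong (λ x → weight (suc x) n + t (b + a)) (sym (*-distribˡ-+ 2 b a)))
                     (weight-odd-odd (b + a) p)
  odd-row : ∀ a → row (suc (2 * a)) ≡ p + t (suc (b + a) + p)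
  odd-row a = trans (cong (λ x → weight x n) (1+2*-+1+2* b a)) (weight-even-odd (suc (b + a)) p)
  pair+letter : ∀ a → pair a + t (b + a) ≡ n + t (suc (b + p) + a)
  pair+letter a = begin
    row (2 * a) + row (suc (2 * a)) + t (b + a)  ≡⟨ xy∙z≈xz∙y (row (2 * a)) _ _ ⟩
    row (2 * a) + t (b + a) + row (suc (2 * a))  ≡⟨ cong₂ _+_ (even-row a) (odd-row a) ⟩
    suc p + (p + t (suc (b + a) + p))            ≡⟨ regroup′ p (t (suc (b + a) + p)) ⟩
    n + t (suc (b + a + p))                      ≡⟨ cong (λ k → n + t (suc k)) (xy∙z≈xz∙y b a p) ⟩
    n + t (suc (b + p) + a)                      ∎
    where
    regroup′ : ∀ p u → suc p + (p + u) ≡ suc (2 * p) + u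
    regroup′ = solve-∀
  regroup : ∀ A W p → A + W + suc p ≡ suc (A + p + W)
  regroup = solve-∀

bounds-by-cancellation : ∀ {o a c b} k l → o + a ≡ c + b → b ≤ k + a → a ≤ l + b →
                         o ≤ k + c × c ≤ l + o
bounds-by-cancellation {o} {a} {c} {b} k l eq b≤k+a a≤l+b =
  +-cancelʳ-≤ a o (k + c) (begin
    o + a        ≡⟨ eq ⟩
    c + b        ≤⟨ +-monoʳ-≤ c b≤k+a ⟩
    c + (k + a)  ≡⟨ x∙yz≈y∙xz c k a ⟩
    k + (c + a)  ≡⟨ +-assoc k c a ⟨
    k + c + a    ∎) ,
  +-cancelʳ-≤ b c (l + o) (begin
    c + b        ≡⟨ eq ⟨
    o + a        ≤⟨ +-monoʳ-≤ o a≤l+b ⟩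
    o + (l + b)  ≡⟨ x∙yz≈y∙xz o l b ⟩
    l + (o + b)  ≡⟨ +-assoc l o b ⟨
    l + o + b    ∎)
  where open ≤-Reasoning

ones-bounds : ∀ i r p → ones i (suc (2 * r)) (suc (2 * p)) ≤ 2 + mid r p ×
                        mid r p ≤ 1 + ones i (suc (2 * r)) (suc (2 * p))
ones-bounds i r p with halving i
... | false +2* b = bounds-by-cancellation 2 1 (ones-even b r p) (proj₁ windows) (proj₂ windows)
  where windows = weight-compare (b + p) b r
... | true  +2* b = map₂ ≤-pred (bounds-by-cancellation 1 2 (ones-odd b r p) (proj₂ windows) (proj₁ windows))
  where windows = weight-compare b (suc (b + p)) r

ones-complement : ∀ i m n → ∃[ i' ] ones i' m n + ones i m n ≡ m * n
ones-complement i m n = i + 2 ^ K , (begin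
  ones (i + 2 ^ K) m n + ones i m n                            ≡⟨ sumTo-+ m _ _ ⟨
  sumTo m (λ k → weight (i + 2 ^ K + k) n + weight (i + k) n)  ≡⟨ sumTo-cong m rows ⟩
  sumTo m (λ _ → n)                                            ≡⟨ sumTo-const m n ⟩
  m * n                                                        ∎)
  where
  open ≡-Reasoning
  K = i + m + n
  rows : ∀ k → k < m → weight (i + 2 ^ K + k) n + weight (i + k) n ≡ n
  rows k k<m = trans (cong (λ x → weight x n + weight (i + k) n) (xy∙z≈xz∙y i (2 ^ K) k))
    (weight-+2^ K n (≤-trans (+-monoˡ-≤ n (+-monoʳ-≤ i (<⇒≤ k<m))) (<⇒≤ (n<2^n K))))

cancel-summand : ∀ {o a c} k → o + a ≡ c + (k + a) → o ≡ k + c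
cancel-summand {o} {a} {c} k eq =
  +-cancelʳ-≡ a o (k + c) (trans eq (trans (x∙yz≈y∙xz c k a) (sym (+-assoc k c a))))

UpperBoundAttained : ℕ → ℕ → Set
UpperBoundAttained r p = ∃[ i ] ones i (suc (2 * r)) (suc (2 * p)) ≡ 2 + mid r p

attained-even-start : ∀ b r p → weight (b + p) (suc r) ≡ 2 + weight b r → UpperBoundAttained r p
attained-even-start b r p heavier =
  2 * b , cancel-summand 2 (trans (ones-even b r p) (cong (mid r p +_) heavier))

attained-odd-start : ∀ b r p → weight (suc (b + p)) r ≡ 1 + weight b (suc r) → UpperBoundAttained r p
attained-odd-start b r p heavier =
  suc (2 * b) , cancel-summand 1 (trans (ones-odd b r p) (cong (suc (mid r p) +_) heavier))

attained-even-even : ∀ {q s} → 1 ≤ q → 1 ≤ s → UpperBoundAttained (2 * q) (2 * s)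
attained-even-even {q} {s} 1≤q 1≤s with pattern-100 1≤q 1≤s
... | y , ty≡1 , tyq≡0 , tys≡0 = attained-even-start (suc (2 * y)) (2 * q) (2 * s) (begin
  weight (suc (2 * y + 2 * s)) (suc (2 * q))  ≡⟨ cong (λ x → weight (suc x) (suc (2 * q))) (*-distribˡ-+ 2 y s) ⟨
  weight (suc (2 * (y + s))) (suc (2 * q))    ≡⟨ weight-odd-odd-max (y + s) q tys≡0 ⟩
  suc q                                       ≡⟨ cong suc (weight-odd-even-min y q ty≡1 tyq≡0) ⟨
  2 + weight (suc (2 * y)) (2 * q)            ∎)
  where open ≡-Reasoning

attained-even-odd : ∀ {q s} → 1 ≤ q → UpperBoundAttained (2 * q) (suc (2 * s))
attained-even-odd {q} {s} 1≤q with pattern-101 1≤q (m<m+n q {suc s} (s≤s z≤n))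
... | y , ty≡1 , tyq≡0 , tyqs≡1 = attained-even-start (suc (2 * y)) (2 * q) (suc (2 * s)) (begin
  weight (suc (2 * y) + suc (2 * s)) (suc (2 * q))  ≡⟨ cong (λ x → weight x (suc (2 * q))) (1+2*-+1+2* y s) ⟩
  weight (2 * suc (y + s)) (suc (2 * q))
    ≡⟨ weight-even-odd-max (suc (y + s)) q (trans (cong t (regroup y s q)) tyqs≡1) ⟩
  suc q                                             ≡⟨ cong suc (weight-odd-even-min y q ty≡1 tyq≡0) ⟨
  2 + weight (suc (2 * y)) (2 * q)                  ∎)
  where
  open ≡-Reasoning
  regroup : ∀ y s q → suc (y + s) + q ≡ y + (q + suc s)
  regroup = solve-∀

attained-odd-even : ∀ {q s} → 1 ≤ s → UpperBoundAttained (suc (2 * q)) (2 * s)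
attained-odd-even {q} {s} 1≤s with pattern-101 1≤s (m<m+n s {suc q} (s≤s z≤n))
... | y , ty≡1 , tys≡0 , tysq≡1 = attained-even-start (suc (2 * y)) (suc (2 * q)) (2 * s) (begin
  weight (suc (2 * y + 2 * s)) (suc (suc (2 * q)))
    ≡⟨ cong₂ (λ x L → weight (suc x) L) (*-distribˡ-+ 2 y s) (*-suc 2 q) ⟨
  weight (suc (2 * (y + s))) (2 * suc q)
    ≡⟨ weight-odd-even-max (y + s) (suc q) tys≡0 (trans (cong t (+-assoc y s (suc q))) tysq≡1) ⟩
  suc (suc q)                                       ≡⟨ cong (2 +_) (weight-odd-odd-min y q ty≡1) ⟨
  2 + weight (suc (2 * y)) (suc (2 * q))            ∎)
  where open ≡-Reasoning

attained-odd-odd : ∀ {q s} → UpperBoundAttained (suc (2 * q)) (suc (2 * s))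
attained-odd-odd {q} {s} with pattern-100 {suc q} {suc s} (s≤s z≤n) (s≤s z≤n)
... | y , ty≡1 , tyq≡0 , tys≡0 = attained-odd-start (suc (2 * y)) (suc (2 * q)) (suc (2 * s)) (begin
  weight (suc (suc (2 * y) + suc (2 * s))) (suc (2 * q))
    ≡⟨ cong (λ x → weight (suc x) (suc (2 * q))) (1+2*-+1+2* y s) ⟩
  weight (suc (2 * suc (y + s))) (suc (2 * q))
    ≡⟨ weight-odd-odd-max (suc (y + s)) q (trans (cong t (sym (+-suc y s))) tys≡0) ⟩
  suc q                                                   ≡⟨ weight-odd-even-min y (suc q) ty≡1 tyq≡0 ⟨
  suc (weight (suc (2 * y)) (2 * suc q))                  ≡⟨ cong (λ L → suc (weight (suc (2 * y)) L)) (*-suc 2 q) ⟩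
  1 + weight (suc (2 * y)) (suc (suc (2 * q)))            ∎)
  where open ≡-Reasoning

upper-bound-attained : ∀ r p → 1 ≤ r → 1 ≤ p → UpperBoundAttained r p
upper-bound-attained r p 1≤r 1≤p with halving r | halving p
... | false +2* q | false +2* s = attained-even-even {q} {s} (1≤2*n⇒1≤n {q} 1≤r) (1≤2*n⇒1≤n {s} 1≤p)
... | false +2* q | true  +2* s = attained-even-odd {q} {s} (1≤2*n⇒1≤n {q} 1≤r)
... | true  +2* q | false +2* s = attained-odd-even {q} {s} (1≤2*n⇒1≤n {s} 1≤p)
... | true  +2* q | true  +2* s = attained-odd-odd {q} {s}

-- Extreme values and parity

dist≡∣-∣ : ∀ a b → dist a b ≡ ∣ a - b ∣
dist≡∣-∣ zero    zero    = refl
dist≡∣-∣ zero    (suc b) = refl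
dist≡∣-∣ (suc a) zero    = +-identityʳ (suc a)
dist≡∣-∣ (suc a) (suc b) = dist≡∣-∣ a b

∣-∣≤ : ∀ a b {d} → a ≤ b + d → b ≤ a + d → ∣ a - b ∣ ≤ d
∣-∣≤ zero    b       _           b≤d         = b≤d
∣-∣≤ (suc a) zero    a≤d         _           = a≤d
∣-∣≤ (suc a) (suc b) (s≤s a≤b+d) (s≤s b≤a+d) = ∣-∣≤ a b a≤b+d b≤a+d

∣-∣≡⇒ : ∀ a b {d} → ∣ a - b ∣ ≡ d → a ≡ b + d ⊎ b ≡ a + d
∣-∣≡⇒ zero    b       eq = inj₂ eq
∣-∣≡⇒ (suc a) zero    eq = inj₁ eq
∣-∣≡⇒ (suc a) (suc b) eq = Sum.map (cong suc) (cong suc) (∣-∣≡⇒ a b eq)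

extremes-complementary : ∀ (f : ℕ → ℕ) {N d} → (∀ i → ∃[ i' ] f i' + f i ≡ N) →
                         (∀ i j → f i ≤ f j + d) → ∀ {i j} → f i ≡ f j + d → N ≡ f j + f i
extremes-complementary f {N} {d} complement below {i} {j} fi≡fj+d with complement i | complement j
... | i' , fi'+fi≡N | j' , fj'+fj≡N = trans (sym fi'+fi≡N) (cong (_+ f i) fi'≡fj)
  where
  fj'≡fi'+d : f j' ≡ f i' + d
  fj'≡fi'+d = +-cancelʳ-≡ (f j) (f j') (f i' + d) (begin
    f j' + f j        ≡⟨ trans fj'+fj≡N (sym fi'+fi≡N) ⟩
    f i' + f i        ≡⟨ cong (f i' +_) fi≡fj+d ⟩
    f i' + (f j + d)  ≡⟨ x∙yz≈x∙zy (f i') (f j) d ⟩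
    f i' + (d + f j)  ≡⟨ +-assoc (f i') d (f j) ⟨
    f i' + d + f j    ∎)
    where open ≡-Reasoning
  fi'≡fj : f i' ≡ f j
  fi'≡fj = ≤-antisym (+-cancelʳ-≤ d (f i') (f j) (subst (_≤ f j + d) fj'≡fi'+d (below j' j)))
                     (+-cancelʳ-≤ d (f j) (f i') (subst (_≤ f i' + d) fi≡fj+d (below i i')))

spread-parity : ∀ (f : ℕ → ℕ) {N d} → (∀ i → ∃[ i' ] f i' + f i ≡ N) →
                (∀ i j → dist (f i) (f j) ≤ d) → ∀ {i j} → dist (f i) (f j) ≡ d → ∃[ k ] N ≡ d + k * 2
spread-parity f {N} {d} complement bounded {i} {j} spread =
  [ from-extremes , from-extremes ]′ (∣-∣≡⇒ (f i) (f j) (trans (sym (dist≡∣-∣ (f i) (f j))) spread))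
  where
  below : ∀ i j → f i ≤ f j + d
  below i j = ≤-trans (m≤n+∣m-n∣ (f i) (f j))
                      (+-monoʳ-≤ (f j) (subst (_≤ d) (dist≡∣-∣ (f i) (f j)) (bounded i j)))
  from-extremes : ∀ {i j} → f i ≡ f j + d → ∃[ k ] N ≡ d + k * 2
  from-extremes {i} {j} fi≡fj+d = f j , (begin
    N                ≡⟨ extremes-complementary f complement below fi≡fj+d ⟩
    f j + f i        ≡⟨ cong (f j +_) fi≡fj+d ⟩
    f j + (f j + d)  ≡⟨ regroup (f j) d ⟩
    d + f j * 2      ∎)
    where
    open ≡-Reasoning
    regroup : ∀ x d → x + (x + d) ≡ d + x * 2
    regroup = solve-∀

odd-factors : ∀ m n → m * n % 2 ≡ 1 → m % 2 ≡ 1 × n % 2 ≡ 1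
odd-factors m n mn-odd with m % 2 | m%n<n m 2 | n % 2 | m%n<n n 2 | trans (sym mn-odd) (%-distribˡ-* m n 2)
... | 1           | _            | 1           | _            | _  = refl , refl
... | 0           | _            | _           | _            | ()
... | 1           | _            | 0           | _            | ()
... | suc (suc _) | s≤s (s≤s ()) | _           | _            | _
... | 1           | _            | suc (suc _) | s≤s (s≤s ()) | _

odd⇒1+2* : ∀ m → m % 2 ≡ 1 → m ≡ suc (2 * (m / 2))
odd⇒1+2* m m-odd = trans (m≡m%n+[m/n]*n m 2) (cong₂ _+_ m-odd (*-comm (m / 2) 2))

3≤1+2*⇒1≤ : ∀ {r} → 3 ≤ suc (2 * r) → 1 ≤ r
3≤1+2*⇒1≤ {zero}  (s≤s ())
3≤1+2*⇒1≤ {suc r} _ = s≤s z≤n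

ones-within-3 : ∀ r p i j → ones i (suc (2 * r)) (suc (2 * p)) ≤ ones j (suc (2 * r)) (suc (2 * p)) + 3
ones-within-3 r p i j = begin
  ones i (suc (2 * r)) (suc (2 * p))      ≤⟨ proj₁ (ones-bounds i r p) ⟩
  2 + mid r p                             ≤⟨ +-monoʳ-≤ 2 (proj₂ (ones-bounds j r p)) ⟩
  3 + ones j (suc (2 * r)) (suc (2 * p))  ≡⟨ +-comm 3 _ ⟩
  ones j (suc (2 * r)) (suc (2 * p)) + 3  ∎
  where open ≤-Reasoning

complement-of-maximum : ∀ {r p x x'} → x ≡ 2 + mid r p → x' + x ≡ suc (2 * r) * suc (2 * p) →
                        x ≡ x' + 3
complement-of-maximum {r} {p} {x} {x'} x≡2+mid x'+x≡mn = +-cancelʳ-≡ x x (x' + 3) (begin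
  x + x                          ≡⟨ cong₂ _+_ x≡2+mid x≡2+mid ⟩
  2 + mid r p + (2 + mid r p)    ≡⟨ regroup r p ⟩
  3 + suc (2 * r) * suc (2 * p)  ≡⟨ cong (3 +_) x'+x≡mn ⟨
  3 + (x' + x)                   ≡⟨ x∙yz≈y∙xz 3 x' x ⟩
  x' + (3 + x)                   ≡⟨ +-assoc x' 3 x ⟨
  x' + 3 + x                     ∎)
  where
  open ≡-Reasoning
  regroup : ∀ r p → 2 + (r * suc (2 * p) + p) + (2 + (r * suc (2 * p) + p)) ≡
                    3 + suc (2 * r) * suc (2 * p)
  regroup = solve-∀

max-diff-odd : ∀ r p → 1 ≤ r → 1 ≤ p → MaxDiffIs (suc (2 * r)) (suc (2 * p)) 3
max-diff-odd r p 1≤r 1≤p with upper-bound-attained r p 1≤r 1≤p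
... | i , maximal with ones-complement i (suc (2 * r)) (suc (2 * p))
...   | i' , complementary = bounded , i , i' , (begin
  dist (f i) (f i')    ≡⟨ dist≡∣-∣ (f i) (f i') ⟩
  ∣ f i - f i' ∣       ≡⟨ cong ∣_- f i' ∣ (complement-of-maximum {r} {p} {f i} {f i'} maximal complementary) ⟩
  ∣ f i' + 3 - f i' ∣  ≡⟨ ∣-∣-comm (f i' + 3) (f i') ⟩
  ∣ f i' - f i' + 3 ∣  ≡⟨ ∣m-m+n∣≡n (f i') 3 ⟩
  3                    ∎)
  where
  open ≡-Reasoning
  f : ℕ → ℕ
  f i = ones i (suc (2 * r)) (suc (2 * p))
  bounded : ∀ i j → dist (f i) (f j) ≤ 3
  bounded i j = subst (_≤ 3) (sym (dist≡∣-∣ (f i) (f j)))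
                      (∣-∣≤ (f i) (f j) (ones-within-3 r p i j) (ones-within-3 r p j i))

theorem13 : (m n : ℕ) → 3 ≤ m → 3 ≤ n → (MaxDiffIs m n 3 ⇔ ((m % 2 ≡ 1) × (n % 2 ≡ 1)))
theorem13 m n 3≤m 3≤n = mk⇔ sides-odd max-diff
  where
  sides-odd : MaxDiffIs m n 3 → (m % 2 ≡ 1) × (n % 2 ≡ 1)
  sides-odd (bounded , i , j , spread)
    with spread-parity (λ i → ones i m n) (λ i → ones-complement i m n) bounded {i} {j} spread
  ... | k , mn≡3+2k = odd-factors m n (trans (cong (_% 2) mn≡3+2k) ([m+kn]%n≡m%n 3 k 2))
  max-diff : (m % 2 ≡ 1) × (n % 2 ≡ 1) → MaxDiffIs m n 3
  max-diff (m-odd , n-odd) =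
    subst₂ (λ m n → MaxDiffIs m n 3) (sym m≡1+2r) (sym n≡1+2p)
      (max-diff-odd (m / 2) (n / 2) (3≤1+2*⇒1≤ (subst (3 ≤_) m≡1+2r 3≤m))
                                    (3≤1+2*⇒1≤ (subst (3 ≤_) n≡1+2p 3≤n)))
    where
    m≡1+2r = odd⇒1+2* m m-odd
    n≡1+2p = odd⇒1+2* n n-odd
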